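{- Let $T$ be a tree and let $I, J$ be independent sets of $T$ with $|I|=|J|$ such that $I$ is reconfigurable to $J$ (a $\mathsf{TS}$-sequence between them exists). Then every $\mathsf{TS}$-sequence $S$ between $I$ and $J$ in $T$ satisfies $\mathsf{len}(S) \ge M^*(T, I, J) + D^*(T, I, J)$.
   Context: A $\mathsf{TS}$-sequence in a graph $G$ between independent sets $I$ and $J$ with $|I|=|J|$ is a sequence $\langle I_1, \dots, I_\ell\rangle$ of independent sets with $I_1 = I$, $I_\ell = J$, all of size $|I|$, such that for each $2\le i\le \ell$ there is an edge $xy$ with $I_{i-1}\setminus I_i=\{x\}$, $I_i\setminus I_{i-1}=\{y\}$; this step is written $x \to y$ (a token slides from $x$ to $y$). $\mathsf{len}(S)=\ell-1$. A target assignment is a bijection $f: I \to J$; $M^*(G,I,J) = \min_f \sum_{w\in I} \mathsf{dist}_G(w, f(w))$ over all bijections $f: I\to J$. For an edge $e = xy$, $D_G(S,e)$ is twice the minimum of the number of occurrences of the step $x\to y$ in $S$ and the number of occurrences of the step $y \to x$ in $S$ (regardless of which tokens perform them); $D_G(S) = \sum_{e\in E(G)} D_G(S,e)$; and $D^*(G,I,J)$ is the minimum of $D_G(S)$ over all $\mathsf{TS}$-sequences $S$ between $I$ and $J$ in $G$. -}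

module Defs where

open import Data.Nat using (ℕ; zero; suc; _+_; _*_; _≤_; _⊔_; _⊓_; _<ᵇ_)
open import Data.Bool using (Bool; true; false; T; _∧_; if_then_else_)
open import Data.Fin using (Fin; toℕ; _≟_)
open import Data.Fin.Subset using (Subset; _∈_; _∉_; ∣_∣)
open import Data.Fin.Subset.Properties using (_∈?_)
open import Data.List using (List; []; _∷_; map; length; allFin)
open import Data.Nat.ListAction using (sum)
open import Data.List.Relation.Unary.Unique.Propositional using (Unique)
open import Data.Product using (Σ; ∃; _×_; _,_; proj₁)
open import Relation.Nullary using (¬_; Dec; yes; no)
open import Relation.Binary.PropositionalEquality using (_≡_; _≢_)
open import Function.Bundles using (_⤖_; Bijection)

record Graph (n : ℕ) : Set where
  field
    adj    : Fin n → Fin n → Bool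
    sym    : ∀ x y → adj x y ≡ adj y x
    irrefl : ∀ x → adj x x ≡ false

module _ {n : ℕ} (G : Graph n) where
  open Graph G

  Adj : Fin n → Fin n → Set
  Adj x y = T (adj x y)

  data Walk : Fin n → Fin n → Set where
    []  : ∀ {u} → Walk u u
    _∷_ : ∀ {u v w} → Adj u v → Walk v w → Walk u w

  wlen : ∀ {u v} → Walk u v → ℕ
  wlen []      = 0
  wlen (_ ∷ W) = suc (wlen W)

  Connected : Set
  Connected = ∀ u v → Walk u v

  private
    ChainFrom : Fin n → List (Fin n) → Fin n → Set
    ChainFrom first []       prev = Adj prev first
    ChainFrom first (x ∷ xs) prev = Adj prev x × ChainFrom first xs x

  IsCycle : List (Fin n) → Set
  IsCycle []       = Data.Empty.⊥
    where import Data.Empty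
  IsCycle (v ∷ vs) = (3 ≤ length (v ∷ vs)) × Unique (v ∷ vs) × ChainFrom v vs v

  Acyclic : Set
  Acyclic = ¬ (Σ (List (Fin n)) IsCycle)

  IsTree : Set
  IsTree = Connected × Acyclic

  IsDist : Fin n → Fin n → ℕ → Set
  IsDist u v d = (Σ (Walk u v) λ W → wlen W ≡ d) × (∀ (W : Walk u v) → d ≤ wlen W)

  Independent : Subset n → Set
  Independent I = ∀ x y → x ∈ I → y ∈ I → ¬ Adj x y

  Step : Subset n → Subset n → Fin n → Fin n → Set
  Step I I' x y =
    Adj x y
    × (x ∈ I × x ∉ I' × (∀ z → z ∈ I → z ∉ I' → z ≡ x))
    × (y ∈ I' × y ∉ I × (∀ z → z ∈ I' → z ∉ I → z ≡ y))

  data TSSeqₖ (k : ℕ) : Subset n → Subset n → Set where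
    [_,_] : ∀ {I} → Independent I → ∣ I ∣ ≡ k → TSSeqₖ k I I
    step  : ∀ {I I' J} → Independent I → ∣ I ∣ ≡ k →
            (x y : Fin n) → Step I I' x y → TSSeqₖ k I' J → TSSeqₖ k I J

  TSSeq : Subset n → Subset n → Set
  TSSeq I J = TSSeqₖ ∣ I ∣ I J

  -- len(S) = ℓ - 1
  len : ∀ {k I J} → TSSeqₖ k I J → ℕ
  len [ _ , _ ]            = 0
  len (step _ _ _ _ _ S)   = suc (len S)

  count : ∀ {k I J} → TSSeqₖ k I J → Fin n → Fin n → ℕ
  count [ _ , _ ] a b = 0
  count (step _ _ x y _ S) a b with x ≟ a | y ≟ b
  ... | yes _ | yes _ = suc (count S a b)
  ... | _     | _     = count S a b

  Dedge : ∀ {k I J} → TSSeqₖ k I J → Fin n → Fin n → ℕ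
  Dedge S a b = 2 * (count S a b ⊓ count S b a)

  -- D_G(S) = Σ over edges e = ab (each edge counted once, via toℕ a < toℕ b)
  D : ∀ {k I J} → TSSeqₖ k I J → ℕ
  D S = sum (map (λ a → sum (map (λ b →
          if adj a b ∧ (toℕ a <ᵇ toℕ b) then Dedge S a b else 0) (allFin n))) (allFin n))

  IsDStar : Subset n → Subset n → ℕ → Set
  IsDStar I J d = (Σ (TSSeq I J) λ S → D S ≡ d) × (∀ (S : TSSeq I J) → d ≤ D S)

  Elem : Subset n → Set
  Elem I = Σ (Fin n) (λ v → v ∈ I)

  sumOver : (I : Subset n) → ((v : Fin n) → v ∈ I → ℕ) → ℕ
  sumOver I δ = sum (map (λ v → pick v (v ∈? I)) (allFin n))
    where
      pick : (v : Fin n) → Dec (v ∈ I) → ℕ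
      pick v (yes p) = δ v p
      pick v (no _)  = 0

  HasCost : (I J : Subset n) → Elem I ⤖ Elem J → ℕ → Set
  HasCost I J f c =
    Σ ((v : Fin n) → v ∈ I → ℕ) λ δ →
      (∀ v (p : v ∈ I) → IsDist v (proj₁ (Bijection.to f (v , p))) (δ v p))
      × sumOver I δ ≡ c

  IsMStar : Subset n → Subset n → ℕ → Set
  IsMStar I J m =
    (Σ (Elem I ⤖ Elem J) λ f → HasCost I J f m)
    × (∀ (f : Elem I ⤖ Elem J) c → HasCost I J f c → m ≤ c)

module Submission where

-- Along S, read from its last slide backwards, we keep a permutation π of the vertices mapping the
-- current token set onto J, and show cost π + D(S) ≤ len(S), where cost π = Σ_w dist(w, π w) ≥ M*.
-- Prepending a slide x → y either leaves D unchanged, and then composing π with the transposition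
-- of x and y costs at most one unit (triangle inequality), or raises D by two. The latter happens
-- when the later slides cross the edge xy more often from y to x than from x to y. In a tree that
-- edge is the only passage between its two sides, so J then has more vertices on x's side than the
-- current set, and some token w on y's side is assigned a target on x's side. A shortest path from
-- w to its target runs through y and then x, so giving that target to the sliding token and y's
-- target to w lowers the cost by at least one, which with the extra step pays for the rise of D.

open import Defs
open import Data.Nat using (ℕ; zero; suc; _+_; _*_; _⊓_; _≤_; _<_; _<ᵇ_; _≤?_; _<?_; z≤n; s≤s)
open import Data.Nat.Properties hiding (_≟_; suc-injective)
open import Data.Nat.Induction using (<-rec)
open import Data.Nat.ListAction using (sum)
import Data.Bool as Bool
open import Data.Bool using (Bool; true; false; _∧_; if_then_else_)
open import Data.Bool.Properties using (T?; T-≡)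
open import Data.Fin using (Fin; zero; suc; toℕ; fromℕ<; _≟_)
open import Data.Fin.Properties using (suc-injective; any?; toℕ<n; toℕ-fromℕ<; toℕ-injective)
open import Data.Fin.Subset using (Subset; _∈_; ∣_∣)
open import Data.Fin.Subset.Properties using (_∈?_)
open import Data.Fin.Permutation using (Permutation′; _⟨$⟩ʳ_; _⟨$⟩ˡ_; _∘ₚ_; inverseˡ; inverseʳ)
import Data.Fin.Permutation as Perm
open import Data.Fin.Permutation.Components using (transpose)
open import Data.List using (List; []; _∷_; length; map; allFin; tabulate)
open import Data.List.Properties using (map-tabulate)
open import Data.List.Membership.Propositional using () renaming (_∈_ to _∈ₗ_)
import Data.List.Membership.DecPropositional as DecMembership
open import Data.List.Relation.Unary.Any using (here; there)
open import Data.List.Relation.Unary.All using ([])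
open import Data.List.Relation.Unary.All.Properties using (¬Any⇒All¬)
open import Data.List.Relation.Unary.AllPairs using ([]; _∷_)
open import Data.List.Relation.Unary.Unique.Propositional using (Unique)
open import Data.Vec.Properties.WithK using ([]=-irrelevant)
open import Data.Product using (Σ; ∃; ∃₂; _×_; _,_; proj₁; proj₂)
import Data.Product as Product
open import Data.Sum using (_⊎_; inj₁; inj₂)
open import Data.Empty using (⊥-elim)
open import Function using (_∘_; id; _⇔_; mk⇔; Equivalence; _⤖_; mk⤖)
open import Function.Construct.Composition using (_⇔-∘_)
open import Function.Construct.Symmetry using (⇔-sym)
open import Function.Construct.Identity using (⇔-id)
open import Relation.Nullary using (¬_; Dec; does; yes; no)
open import Relation.Nullary.Decidable using (dec-true; dec-false; decidable-stable; map′; _×-dec_; _⊎-dec_)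
open import Relation.Unary using (Decidable)
open import Relation.Binary.PropositionalEquality hiding ([_])
open import Algebra.Properties.CommutativeMonoid.Sum +-0-commutativeMonoid
  using (sum-cong-≗; sum-replicate-zero; ∑-permute) renaming (sum to ∑)
open import Algebra.Solver.CommutativeMonoid +-0-commutativeMonoid using (solve; _⊕_; _⊜_)

private variable n k : ℕ

sum-map-allFin : (f : Fin n → ℕ) → sum (map f (allFin n)) ≡ ∑ f
sum-map-allFin f = trans (cong sum (map-tabulate id f)) (sum-tabulate f)
  where
  sum-tabulate : ∀ {n} (f : Fin n → ℕ) → sum (tabulate f) ≡ ∑ f
  sum-tabulate {zero}  f = refl
  sum-tabulate {suc n} f = cong (f zero +_) (sum-tabulate (f ∘ suc))

∑-zero : {f : Fin n → ℕ} → (∀ v → f v ≡ 0) → ∑ f ≡ 0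
∑-zero {n} f≗0 = trans (sum-cong-≗ f≗0) (sum-replicate-zero n)

∑-exchange : {f g : Fin n → ℕ} (a : Fin n) → (∀ v → v ≢ a → f v ≡ g v) → ∑ f + g a ≡ ∑ g + f a
∑-exchange {suc n} {f} {g} zero agree = begin
  f zero + ∑ (f ∘ suc) + g zero    ≡⟨ cong (λ s → f zero + s + g zero) (sum-cong-≗ λ v → agree (suc v) λ ()) ⟩
  f zero + ∑ (g ∘ suc) + g zero    ≡⟨ +-comm (f zero + _) (g zero) ⟩
  g zero + (f zero + ∑ (g ∘ suc))  ≡⟨ cong (g zero +_) (+-comm (f zero) _) ⟩
  g zero + (∑ (g ∘ suc) + f zero)  ≡⟨ +-assoc (g zero) _ (f zero) ⟨
  g zero + ∑ (g ∘ suc) + f zero    ∎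
  where open ≡-Reasoning
∑-exchange {suc n} {f} {g} (suc a) agree = begin
  f zero + ∑ (f ∘ suc) + g (suc a)    ≡⟨ +-assoc (f zero) _ _ ⟩
  f zero + (∑ (f ∘ suc) + g (suc a))  ≡⟨ cong₂ _+_ (agree zero λ ())
                                                   (∑-exchange a λ v v≢a → agree (suc v) (v≢a ∘ suc-injective)) ⟩
  g zero + (∑ (g ∘ suc) + f (suc a))  ≡⟨ +-assoc (g zero) _ _ ⟨
  g zero + ∑ (g ∘ suc) + f (suc a)    ∎
  where open ≡-Reasoning

∑-exchange₂ : {f g : Fin n → ℕ} {a b : Fin n} → a ≢ b → (∀ v → v ≢ a → v ≢ b → f v ≡ g v) →
              ∑ f + g a + g b ≡ ∑ g + f a + f b
∑-exchange₂ {f = f} {g} {a} {b} a≢b agree = begin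
  ∑ f + g a + g b    ≡⟨ cong (λ t → ∑ f + t + g b) h-at-a ⟨
  ∑ f + h a + g b    ≡⟨ cong (_+ g b) (∑-exchange {g = h} a f≈h) ⟩
  ∑ h + f a + g b    ≡⟨ solve 3 (λ H p q → (H ⊕ p) ⊕ q ⊜ (H ⊕ q) ⊕ p) refl (∑ h) (f a) (g b) ⟩
  ∑ h + g b + f a    ≡⟨ cong (_+ f a) (∑-exchange {f = h} b h≈g) ⟩
  ∑ g + h b + f a    ≡⟨ cong (λ t → ∑ g + t + f a) h-at-b ⟩
  ∑ g + f b + f a    ≡⟨ solve 3 (λ G p q → (G ⊕ p) ⊕ q ⊜ (G ⊕ q) ⊕ p) refl (∑ g) (f b) (f a) ⟩
  ∑ g + f a + f b    ∎
  where
  open ≡-Reasoning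
  h : Fin _ → ℕ
  h v = if does (v ≟ a) then g a else f v
  f≈h : ∀ v → v ≢ a → f v ≡ h v
  f≈h v v≢a rewrite dec-false (v ≟ a) v≢a = refl
  h≈g : ∀ v → v ≢ b → h v ≡ g v
  h≈g v v≢b with v ≟ a
  ... | yes refl = refl
  ... | no v≢a   = agree v v≢a v≢b
  h-at-a : h a ≡ g a
  h-at-a rewrite dec-true (a ≟ a) refl = refl
  h-at-b : h b ≡ f b
  h-at-b rewrite dec-false (b ≟ a) (a≢b ∘ sym) = refl

∑-<-witness : {f g : Fin n → ℕ} → ∑ f < ∑ g → ∃ λ v → f v < g v
∑-<-witness {zero} ()
∑-<-witness {suc n} {f} {g} ∑f<∑g with f zero <? g zero
... | yes f₀<g₀ = zero , f₀<g₀
... | no f₀≮g₀  =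
  Product.map suc id (∑-<-witness (≰⇒> λ tail≤ → <⇒≱ ∑f<∑g (+-mono-≤ (≮⇒≥ f₀≮g₀) tail≤)))

when : {P : Set} → Dec P → ℕ → ℕ
when (yes _) m = m
when (no _)  _ = 0

when-yes : ∀ {P : Set} {m} (p? : Dec P) → P → when p? m ≡ m
when-yes (yes _) _ = refl
when-yes (no ¬p) p = ⊥-elim (¬p p)

when-no : ∀ {P : Set} {m} (p? : Dec P) → ¬ P → when p? m ≡ 0
when-no (yes p) ¬p = ⊥-elim (¬p p)
when-no (no _)  _  = refl

when-⇔ : ∀ {P Q : Set} {m} → P ⇔ Q → (p? : Dec P) (q? : Dec Q) → when p? m ≡ when q? m
when-⇔ P⇔Q (yes p) q? = sym (when-yes q? (Equivalence.to P⇔Q p))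
when-⇔ P⇔Q (no ¬p) q? = sym (when-no q? (¬p ∘ Equivalence.from P⇔Q))

∑∈ : Subset n → (Fin n → ℕ) → ℕ
∑∈ K w = ∑ λ v → when (v ∈? K) (w v)

transpose-ˡ : (i j : Fin n) → transpose i j i ≡ j
transpose-ˡ i j rewrite dec-true (i ≟ i) refl = refl

transpose-ʳ : (i j : Fin n) → transpose i j j ≡ i
transpose-ʳ i j with j ≟ i
... | yes j≡i = j≡i
... | no _ rewrite dec-true (j ≟ j) refl = refl

transpose-other : {i j v : Fin n} → v ≢ i → v ≢ j → transpose i j v ≡ v
transpose-other {i = i} {j} {v} v≢i v≢j rewrite dec-false (v ≟ i) v≢i | dec-false (v ≟ j) v≢j = refl

transpose-diag : (i v : Fin n) → transpose i i v ≡ v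
transpose-diag i v with v ≟ i in v≟i
... | yes v≡i = sym v≡i
... | no _ rewrite v≟i = refl

transpose-∈⇔ : ∀ {K : Subset n} {i j} → i ∈ K → j ∈ K → ∀ v → v ∈ K ⇔ transpose i j v ∈ K
transpose-∈⇔ {K = K} {i} {j} i∈K j∈K v = cases (v ≟ i) (v ≟ j)
  where
  cases : Dec (v ≡ i) → Dec (v ≡ j) → v ∈ K ⇔ transpose i j v ∈ K
  cases (yes refl) _          rewrite transpose-ˡ v j = mk⇔ (λ _ → j∈K) (λ _ → i∈K)
  cases (no _)     (yes refl) rewrite transpose-ʳ i v = mk⇔ (λ _ → i∈K) (λ _ → j∈K)
  cases (no v≢i)   (no v≢j)   rewrite transpose-other v≢i v≢j = ⇔-id _

∑∈-swap : ∀ {K : Subset n} {i j} → i ∈ K → j ∈ K → (c : Fin n → Fin n → ℕ) →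
          ∑∈ K (λ v → c v (transpose i j v)) + c i i + c j j ≡ ∑∈ K (λ v → c v v) + c i j + c j i
∑∈-swap {K = K} {i} {j} i∈K j∈K c with i ≟ j
... | yes refl rewrite sum-cong-≗ (λ v → cong (λ u → when (v ∈? K) (c v u)) (transpose-diag i v)) = refl
... | no i≢j = begin
  ∑ f + c i i + c j j  ≡⟨ cong₂ (λ s t → ∑ f + s + t) (when-yes (i ∈? K) i∈K) (when-yes (j ∈? K) j∈K) ⟨
  ∑ f + g i + g j      ≡⟨ ∑-exchange₂ i≢j agree ⟩
  ∑ g + f i + f j      ≡⟨ cong₂ (λ s t → ∑ g + s + t) (trans (when-yes (i ∈? K) i∈K) (cong (c i) (transpose-ˡ i j)))
                                                      (trans (when-yes (j ∈? K) j∈K) (cong (c j) (transpose-ʳ i j))) ⟩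
  ∑ g + c i j + c j i  ∎
  where
  open ≡-Reasoning
  f g : Fin _ → ℕ
  f v = when (v ∈? K) (c v (transpose i j v))
  g v = when (v ∈? K) (c v v)
  agree : ∀ v → v ≢ i → v ≢ j → f v ≡ g v
  agree v v≢i v≢j rewrite transpose-other v≢i v≢j = refl

record MapsOnto (π : Permutation′ n) (K J : Subset n) : Set where
  constructor mapsOnto
  field ∈⇔ : ∀ v → v ∈ K ⇔ π ⟨$⟩ʳ v ∈ J

maps-swap : ∀ {K J : Subset n} {π i j} → i ∈ K → j ∈ K → MapsOnto π K J → MapsOnto (Perm.transpose i j ∘ₚ π) K J
maps-swap {i = i} {j} i∈K j∈K (mapsOnto maps) = mapsOnto λ v → maps (transpose i j v) ⇔-∘ transpose-∈⇔ i∈K j∈K v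

minimal : {P : ℕ → Set} → Decidable P → ∀ {m} → P m → ∃ λ k → P k × (∀ {j} → P j → k ≤ j)
minimal {P = P} P? {m} = <-rec (λ m → P m → Minimum) search m
  where
  Minimum = ∃ λ k → P k × (∀ {j} → P j → k ≤ j)
  search : ∀ m → (∀ {j} → j < m → P j → Minimum) → P m → Minimum
  search m below pm with any? {P = P ∘ toℕ} (P? ∘ toℕ)
  ... | yes (i , pi) = below (toℕ<n i) pi
  ... | no none       = m , pm , λ {j} pj → ≮⇒≥ λ j<m → none (fromℕ< j<m , subst P (sym (toℕ-fromℕ< j<m)) pj)

SameEdge : Fin n → Fin n → Fin n → Fin n → Set
SameEdge a b x y = (a ≡ x × b ≡ y) ⊎ (a ≡ y × b ≡ x)

SameEdge-swap : ∀ {a b x y : Fin n} → SameEdge a b x y → SameEdge b a x y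
SameEdge-swap (inj₁ (a≡x , b≡y)) = inj₂ (b≡y , a≡x)
SameEdge-swap (inj₂ (a≡y , b≡x)) = inj₁ (b≡x , a≡y)

module _ {n : ℕ} (G : Graph n) where

  Adj-sym : ∀ {a b} → Adj G a b → Adj G b a
  Adj-sym {a} {b} = subst Bool.T (Graph.sym G a b)

  Adj⇒≢ : ∀ {a b} → Adj G a b → a ≢ b
  Adj⇒≢ {a} a~b refl = subst Bool.T (Graph.irrefl G a) a~b

  step-∈⇔ : ∀ {K K′ x y v} → Step G K K′ x y → v ≢ x → v ≢ y → v ∈ K ⇔ v ∈ K′
  step-∈⇔ {K} {K′} {v = v} (_ , (_ , _ , only-x-leaves) , (_ , _ , only-y-arrives)) v≢x v≢y = mk⇔
    (λ v∈K  → decidable-stable (v ∈? K′) λ v∉K′ → v≢x (only-x-leaves v v∈K v∉K′))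
    (λ v∈K′ → decidable-stable (v ∈? K) λ v∉K → v≢y (only-y-arrives v v∈K′ v∉K))

  step-transpose-∈⇔ : ∀ {K K′ x y} → Step G K K′ x y → ∀ v → v ∈ K ⇔ transpose x y v ∈ K′
  step-transpose-∈⇔ {K} {K′} {x} {y} slide@(_ , (x∈K , x∉K′ , _) , (y∈K′ , y∉K , _)) v = cases (v ≟ x) (v ≟ y)
    where
    cases : Dec (v ≡ x) → Dec (v ≡ y) → v ∈ K ⇔ transpose x y v ∈ K′
    cases (yes refl) _          rewrite transpose-ˡ v y = mk⇔ (λ _ → y∈K′) (λ _ → x∈K)
    cases (no _)     (yes refl) rewrite transpose-ʳ x v = mk⇔ (⊥-elim ∘ y∉K) (⊥-elim ∘ x∉K′)
    cases (no v≢x)   (no v≢y)   rewrite transpose-other v≢x v≢y = step-∈⇔ slide v≢x v≢y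

  maps-slide : ∀ {K K′ J x y} {π : Permutation′ n} → Step G K K′ x y → MapsOnto π K′ J →
               MapsOnto (Perm.transpose x y ∘ₚ π) K J
  maps-slide {x = x} {y} slide (mapsOnto maps) = mapsOnto λ v → maps (transpose x y v) ⇔-∘ step-transpose-∈⇔ slide v

  ∑∈-slide : ∀ {K K′ x y} → Step G K K′ x y → (c : Fin n → Fin n → ℕ) →
             ∑∈ K (λ v → c v (transpose x y v)) + c y y ≡ ∑∈ K′ (λ v → c v v) + c x y
  ∑∈-slide {K} {K′} {x} {y} slide@(x~y , (x∈K , x∉K′ , _) , (y∈K′ , y∉K , _)) c = begin
    ∑ f + c y y      ≡⟨ cong (_+ c y y) (+-identityʳ (∑ f)) ⟨
    ∑ f + 0 + c y y  ≡⟨ cong₂ (λ s t → ∑ f + s + t) (when-no (x ∈? K′) x∉K′) (when-yes (y ∈? K′) y∈K′) ⟨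
    ∑ f + g x + g y  ≡⟨ ∑-exchange₂ (Adj⇒≢ x~y) agree ⟩
    ∑ g + f x + f y  ≡⟨ cong₂ (λ s t → ∑ g + s + t) (trans (when-yes (x ∈? K) x∈K) (cong (c x) (transpose-ˡ x y)))
                                                  (when-no (y ∈? K) y∉K) ⟩
    ∑ g + c x y + 0  ≡⟨ +-identityʳ _ ⟩
    ∑ g + c x y      ∎
    where
    open ≡-Reasoning
    f g : Fin n → ℕ
    f v = when (v ∈? K) (c v (transpose x y v))
    g v = when (v ∈? K′) (c v v)
    agree : ∀ v → v ≢ x → v ≢ y → f v ≡ g v
    agree v v≢x v≢y rewrite transpose-other v≢x v≢y = when-⇔ (step-∈⇔ slide v≢x v≢y) (v ∈? K) (v ∈? K′)

  _++ʷ_ : ∀ {u v w} → Walk G u v → Walk G v w → Walk G u w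
  []      ++ʷ W = W
  (e ∷ V) ++ʷ W = e ∷ (V ++ʷ W)

  wlen-++ : ∀ {u v w} (V : Walk G u v) (W : Walk G v w) → wlen G (V ++ʷ W) ≡ wlen G V + wlen G W
  wlen-++ []      W = refl
  wlen-++ (e ∷ V) W = cong suc (wlen-++ V W)

  WalkOfLength : Fin n → Fin n → ℕ → Set
  WalkOfLength u v k = Σ (Walk G u v) λ W → wlen G W ≡ k

  walkOfLength? : ∀ u v k → Dec (WalkOfLength u v k)
  walkOfLength? u v zero = map′ (λ { refl → [] , refl }) (λ { ([] , _) → refl }) (u ≟ v)
  walkOfLength? u v (suc k) =
    map′ (λ { (w , e , W , refl) → e ∷ W , refl }) (λ { (e ∷ W , |W|) → _ , e , W , Data.Nat.Properties.suc-injective |W| })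
         (any? λ w → T? (Graph.adj G u w) ×-dec walkOfLength? w v k)

  data AvoidingWalk (x y : Fin n) : Fin n → Fin n → Set where
    []     : ∀ {u} → AvoidingWalk x y u u
    _∷⟨_⟩_ : ∀ {a b c} → Adj G a b → ¬ SameEdge a b x y → AvoidingWalk x y b c → AvoidingWalk x y a c

  module _ {x y : Fin n} where

    _++ᵃ_ : ∀ {u v w} → AvoidingWalk x y u v → AvoidingWalk x y v w → AvoidingWalk x y u w
    []             ++ᵃ W = W
    (e ∷⟨ ¬xy ⟩ V) ++ᵃ W = e ∷⟨ ¬xy ⟩ (V ++ᵃ W)

    reverseᵃ : ∀ {u v} → AvoidingWalk x y u v → AvoidingWalk x y v u
    reverseᵃ []             = []
    reverseᵃ (e ∷⟨ ¬xy ⟩ W) = reverseᵃ W ++ᵃ (Adj-sym e ∷⟨ ¬xy ∘ SameEdge-swap ⟩ [])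

    vertices : ∀ {u v} → AvoidingWalk x y u v → List (Fin n)
    vertices {u} []           = u ∷ []
    vertices {u} (_ ∷⟨ _ ⟩ W) = u ∷ vertices W

    AvoidingPath : Fin n → Fin n → Set
    AvoidingPath u v = Σ (AvoidingWalk x y u v) (Unique ∘ vertices)

    private
      open DecMembership (_≟_ {n}) using () renaming (_∈?_ to _∈ₗ?_)

      suffixFrom : ∀ {a u v} (W : AvoidingWalk x y a v) → Unique (vertices W) → u ∈ₗ vertices W → AvoidingPath u v
      suffixFrom []               uq       (here refl)  = [] , uq
      suffixFrom W@(_ ∷⟨ _ ⟩ _)   uq       (here refl)  = W , uq
      suffixFrom (_ ∷⟨ _ ⟩ W)     (_ ∷ uq) (there u∈W) = suffixFrom W uq u∈W

    erase-loops : ∀ {u v} → AvoidingWalk x y u v → AvoidingPath u v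
    erase-loops []                 = [] , ([] ∷ [])
    erase-loops {u} (e ∷⟨ ¬xy ⟩ W) with erase-loops W
    ... | P , uq with u ∈ₗ? vertices P
    ...   | yes u∈P = suffixFrom P uq u∈P
    ...   | no u∉P  = e ∷⟨ ¬xy ⟩ P , ¬Any⇒All¬ _ u∉P ∷ uq

    avoiding-or-shortcut : ∀ {u v} (W : Walk G u v) →
      AvoidingWalk x y u v ⊎ (Σ (Walk G u x) λ P → wlen G P < wlen G W) ⊎ (Σ (Walk G u y) λ P → wlen G P < wlen G W)
    avoiding-or-shortcut [] = inj₁ []
    avoiding-or-shortcut {u} (_∷_ {v = u′} e W) with (u ≟ x ×-dec u′ ≟ y) ⊎-dec (u ≟ y ×-dec u′ ≟ x)
    ... | yes (inj₁ (refl , _)) = inj₂ (inj₁ ([] , s≤s z≤n))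
    ... | yes (inj₂ (refl , _)) = inj₂ (inj₂ ([] , s≤s z≤n))
    ... | no ¬xy with avoiding-or-shortcut W
    ...   | inj₁ A               = inj₁ (e ∷⟨ ¬xy ⟩ A)
    ...   | inj₂ (inj₁ (P , lt)) = inj₂ (inj₁ (e ∷ P , s≤s lt))
    ...   | inj₂ (inj₂ (P , lt)) = inj₂ (inj₂ (e ∷ P , s≤s lt))

  private
    -- `IsCycle` is built from a chain predicate that Defs keeps private; unification recovers it.
    Second : {A B : Set} → (A × B) ≡ (A × B) → Set
    Second {B = B} _ = B

    ChainFrom : Fin n → List (Fin n) → Fin n → Set
    ChainFrom x vs p = Second (refl {x = Second (refl {x = Second (refl {x = IsCycle G (x ∷ p ∷ vs)})})})

    chain : ∀ {x y p b} → Adj G p b → (W : AvoidingWalk x y b y) → Adj G y x → ChainFrom x (vertices W) p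
    chain p~b []             y~x = p~b , y~x
    chain p~b (b~c ∷⟨ _ ⟩ W) y~x = p~b , chain b~c W y~x

  acyclic⇒no-avoiding-walk : Acyclic G → ∀ {x y} → Adj G x y → ¬ AvoidingWalk x y x y
  acyclic⇒no-avoiding-walk acyclic {x} {y} x~y W with erase-loops W
  ... | [] , _            = Adj⇒≢ x~y refl
  ... | _ ∷⟨ ¬xy ⟩ [] , _ = ¬xy (inj₁ (refl , refl))
  ... | e ∷⟨ _ ⟩ W′@(_ ∷⟨ _ ⟩ W″) , uq =
    acyclic (x ∷ vertices W′ , s≤s (s≤s (nonempty W″)) , uq , chain e W′ (Adj-sym x~y))
    where
    nonempty : ∀ {u v} (V : AvoidingWalk x y u v) → 1 ≤ length (vertices V)
    nonempty []           = s≤s z≤n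
    nonempty (_ ∷⟨ _ ⟩ _) = s≤s z≤n

  count-step : ∀ {K K′ J} (K-ind : Independent G K) (K-size : ∣ K ∣ ≡ k) (a b : Fin n) (slide : Step G K K′ a b)
               (S : TSSeqₖ G k K′ J) (c d : Fin n) →
               count G (step K-ind K-size a b slide S) c d ≡ when (a ≟ c ×-dec b ≟ d) 1 + count G S c d
  count-step _ _ a b _ S c d with a ≟ c | b ≟ d
  ... | yes _ | yes _ = refl
  ... | yes _ | no _  = refl
  ... | no _  | _     = refl

  Dedge-sym : ∀ {K J} (S : TSSeqₖ G k K J) a b → Dedge G S a b ≡ Dedge G S b a
  Dedge-sym S a b = cong (2 *_) (⊓-comm (count G S a b) (count G S b a))

  Oriented : Fin n → Fin n → Bool
  Oriented a b = Graph.adj G a b ∧ (toℕ a <ᵇ toℕ b)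

  edgeTerm : ∀ {K J} → TSSeqₖ G k K J → Fin n → Fin n → ℕ
  edgeTerm S a b = if Oriented a b then Dedge G S a b else 0

  D-∑ : ∀ {K J} (S : TSSeqₖ G k K J) → D G S ≡ ∑ λ a → ∑ λ b → edgeTerm S a b
  D-∑ S = trans (sum-map-allFin (λ a → sum (map (edgeTerm S a) (allFin n)))) (sum-cong-≗ λ a → sum-map-allFin (edgeTerm S a))

  D-[] : ∀ {K} (K-ind : Independent G K) (K-size : ∣ K ∣ ≡ k) → D G [ K-ind , K-size ] ≡ 0
  D-[] K-ind K-size = trans (D-∑ [ K-ind , K-size ]) (∑-zero λ a → ∑-zero λ b → if-0 (Oriented a b))
    where
    if-0 : ∀ b → (if b then 0 else 0) ≡ 0
    if-0 true  = refl
    if-0 false = refl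

  private
    oriented-once : ∀ {x y} → Adj G x y → ∀ c → (if Oriented x y then c else 0) + (if Oriented y x then c else 0) ≡ c
    oriented-once {x} {y} x~y c
      rewrite Equivalence.to T-≡ x~y | Equivalence.to T-≡ (Adj-sym x~y)
      with toℕ x <ᵇ toℕ y in x<y | toℕ y <ᵇ toℕ x in y<x
    ... | true  | true  =
      ⊥-elim (<-asym (<ᵇ⇒< (toℕ x) (toℕ y) (subst Bool.T (sym x<y) _)) (<ᵇ⇒< (toℕ y) (toℕ x) (subst Bool.T (sym y<x) _)))
    ... | true  | false = +-identityʳ c
    ... | false | true  = refl
    ... | false | false = ⊥-elim (Adj⇒≢ x~y (toℕ-injective toℕx≡toℕy))
      where
      toℕx≡toℕy : toℕ x ≡ toℕ y
      toℕx≡toℕy = ≤-antisym (≮⇒≥ λ lt → subst Bool.T y<x (<⇒<ᵇ lt)) (≮⇒≥ λ lt → subst Bool.T x<y (<⇒<ᵇ lt))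

    cancel-exchanges : ∀ A⁺ A p⁺ p q⁺ q e e⁺ f f⁺ → p⁺ + e ≡ p + e⁺ → q⁺ + f ≡ q + f⁺ →
                       A⁺ + p + q ≡ A + p⁺ + q⁺ → A⁺ + (e + f) ≡ A + (e⁺ + f⁺)
    cancel-exchanges A⁺ A p⁺ p q⁺ q e e⁺ f f⁺ row-p row-q rows = +-cancelʳ-≡ (p + q + (p⁺ + q⁺)) _ _ (begin
      A⁺ + (e + f) + (p + q + (p⁺ + q⁺))
        ≡⟨ solve 7 (λ A⁺ e f p q p⁺ q⁺ → (A⁺ ⊕ (e ⊕ f)) ⊕ ((p ⊕ q) ⊕ (p⁺ ⊕ q⁺))
                                        ⊜ (((A⁺ ⊕ p) ⊕ q) ⊕ (p⁺ ⊕ e)) ⊕ (q⁺ ⊕ f)) refl A⁺ e f p q p⁺ q⁺ ⟩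
      (A⁺ + p + q) + (p⁺ + e) + (q⁺ + f)
        ≡⟨ cong₂ _+_ (cong₂ _+_ rows row-p) row-q ⟩
      (A + p⁺ + q⁺) + (p + e⁺) + (q + f⁺)
        ≡⟨ solve 7 (λ A e⁺ f⁺ p q p⁺ q⁺ → (((A ⊕ p⁺) ⊕ q⁺) ⊕ (p ⊕ e⁺)) ⊕ (q ⊕ f⁺)
                                        ⊜ (A ⊕ (e⁺ ⊕ f⁺)) ⊕ ((p ⊕ q) ⊕ (p⁺ ⊕ q⁺))) refl A e⁺ f⁺ p q p⁺ q⁺ ⟩
      A + (e⁺ + f⁺) + (p + q + (p⁺ + q⁺)) ∎)
      where open ≡-Reasoning

  module _ {K K′ J x y} (K-ind : Independent G K) (K-size : ∣ K ∣ ≡ k) (slide : Step G K K′ x y)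
           (S : TSSeqₖ G k K′ J) where

    private
      S⁺ : TSSeqₖ G k K J
      S⁺ = step K-ind K-size x y slide S

      x≢y : x ≢ y
      x≢y = Adj⇒≢ (proj₁ slide)

      edgeTerm-step-other : ∀ {a b} → ¬ SameEdge a b x y → edgeTerm S⁺ a b ≡ edgeTerm S a b
      edgeTerm-step-other {a} {b} ¬xy
        rewrite count-step K-ind K-size x y slide S a b | count-step K-ind K-size x y slide S b a
              | when-no {m = 1} (x ≟ a ×-dec y ≟ b) (λ (x≡a , y≡b) → ¬xy (inj₁ (sym x≡a , sym y≡b)))
              | when-no {m = 1} (x ≟ b ×-dec y ≟ a) (λ (x≡b , y≡a) → ¬xy (inj₂ (sym y≡a , sym x≡b))) = refl

      row⁺ row : Fin n → ℕ
      row⁺ a = ∑ (edgeTerm S⁺ a)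
      row  a = ∑ (edgeTerm S a)

      edgeTerm-pair : ∀ {K₀ J₀} (T : TSSeqₖ G k K₀ J₀) → edgeTerm T x y + edgeTerm T y x ≡ Dedge G T x y
      edgeTerm-pair T rewrite Dedge-sym T y x = oriented-once (proj₁ slide) (Dedge G T x y)

      row-x : row⁺ x + edgeTerm S x y ≡ row x + edgeTerm S⁺ x y
      row-x = ∑-exchange {f = edgeTerm S⁺ x} {g = edgeTerm S x} y λ b b≢y → edgeTerm-step-other λ
        { (inj₁ (_ , b≡y)) → b≢y b≡y ; (inj₂ (x≡y , _)) → x≢y x≡y }

      row-y : row⁺ y + edgeTerm S y x ≡ row y + edgeTerm S⁺ y x
      row-y = ∑-exchange {f = edgeTerm S⁺ y} {g = edgeTerm S y} x λ b b≢x → edgeTerm-step-other λ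
        { (inj₁ (y≡x , _)) → x≢y (sym y≡x) ; (inj₂ (_ , b≡x)) → b≢x b≡x }

      other-rows : ∑ row⁺ + row x + row y ≡ ∑ row + row⁺ x + row⁺ y
      other-rows = ∑-exchange₂ {f = row⁺} {g = row} x≢y λ a a≢x a≢y → sum-cong-≗ λ b → edgeTerm-step-other {a} {b} λ
        { (inj₁ (a≡x , _)) → a≢x a≡x ; (inj₂ (a≡y , _)) → a≢y a≡y }

    D-step : D G (step K-ind K-size x y slide S) + Dedge G S x y ≡ D G S + Dedge G (step K-ind K-size x y slide S) x y
    D-step = begin
      D G S⁺ + Dedge G S x y                      ≡⟨ cong₂ _+_ (D-∑ S⁺) (sym (edgeTerm-pair S)) ⟩
      ∑ row⁺ + (edgeTerm S x y + edgeTerm S y x)   ≡⟨ cancel-exchanges (∑ row⁺) (∑ row) _ _ _ _ _ _ _ _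
                                                                      row-x row-y other-rows ⟩
      ∑ row + (edgeTerm S⁺ x y + edgeTerm S⁺ y x)  ≡⟨ cong₂ _+_ (sym (D-∑ S)) (edgeTerm-pair S⁺) ⟩
      D G S + Dedge G S⁺ x y                      ∎
      where open ≡-Reasoning

    private
      Dedge-step : Dedge G S⁺ x y ≡ 2 * (suc (count G S x y) ⊓ count G S y x)
      Dedge-step
        rewrite count-step K-ind K-size x y slide S x y | count-step K-ind K-size x y slide S y x
              | when-yes {m = 1} (x ≟ x ×-dec y ≟ y) (refl , refl)
              | when-no {m = 1} (x ≟ y ×-dec y ≟ x) (x≢y ∘ proj₁) = refl

    D-step-balanced : count G S y x ≤ count G S x y → D G (step K-ind K-size x y slide S) ≡ D G S
    D-step-balanced c₂≤c₁ = +-cancelʳ-≡ (Dedge G S x y) _ _ (trans D-step (cong (D G S +_) unchanged))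
      where
      unchanged : Dedge G S⁺ x y ≡ Dedge G S x y
      unchanged = trans Dedge-step
        (cong (2 *_) (trans (m≥n⇒m⊓n≡n (m≤n⇒m≤1+n c₂≤c₁)) (sym (m≥n⇒m⊓n≡n c₂≤c₁))))

    D-step-≤ : D G (step K-ind K-size x y slide S) ≤ 2 + D G S
    D-step-≤ = +-cancelʳ-≤ (Dedge G S x y) _ _ (begin
      D G S⁺ + Dedge G S x y       ≡⟨ D-step ⟩
      D G S + Dedge G S⁺ x y       ≤⟨ +-monoʳ-≤ (D G S) grows-by-2 ⟩
      D G S + (2 + Dedge G S x y)  ≡⟨ +-assoc (D G S) 2 _ ⟨
      D G S + 2 + Dedge G S x y    ≡⟨ cong (_+ Dedge G S x y) (+-comm (D G S) 2) ⟩
      2 + D G S + Dedge G S x y    ∎)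
      where
      open ≤-Reasoning
      c₁ = count G S x y
      c₂ = count G S y x
      grows-by-2 : Dedge G S⁺ x y ≤ 2 + Dedge G S x y
      grows-by-2 = begin
        Dedge G S⁺ x y        ≡⟨ Dedge-step ⟩
        2 * (suc c₁ ⊓ c₂)     ≤⟨ *-monoʳ-≤ 2 (⊓-monoʳ-≤ (suc c₁) (n≤1+n c₂)) ⟩
        2 * suc (c₁ ⊓ c₂)     ≡⟨ *-suc 2 _ ⟩
        2 + 2 * (c₁ ⊓ c₂)     ∎

  module Distance (connected : Connected G) where

    private
      shortest : ∀ u v → ∃ λ k → WalkOfLength u v k × (∀ {j} → WalkOfLength u v j → k ≤ j)
      shortest u v = minimal (walkOfLength? u v) (connected u v , refl)

    dist : Fin n → Fin n → ℕ
    dist u v = proj₁ (shortest u v)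

    dist-isDist : ∀ u v → IsDist G u v (dist u v)
    dist-isDist u v = proj₁ (proj₂ (shortest u v)) , λ W → proj₂ (proj₂ (shortest u v)) (W , refl)

    shortest-walk : ∀ u v → WalkOfLength u v (dist u v)
    shortest-walk u v = proj₁ (dist-isDist u v)

    dist-minimal : ∀ {u v} (W : Walk G u v) → dist u v ≤ wlen G W
    dist-minimal = proj₂ (dist-isDist _ _)

    dist-refl : ∀ v → dist v v ≡ 0
    dist-refl v = n≤0⇒n≡0 (dist-minimal {v} [])

    dist≡0⇒≡ : ∀ {u v} → dist u v ≡ 0 → u ≡ v
    dist≡0⇒≡ {u} {v} d≡0 with shortest-walk u v
    ... | [] , _ = refl
    ... | _ ∷ _ , len≡d = ⊥-elim (1+n≢0 (trans len≡d d≡0))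

    dist-triangle : ∀ u v w → dist u w ≤ dist u v + dist v w
    dist-triangle u v w with shortest-walk u v | shortest-walk v w
    ... | V , |V| | W , |W| = ≤-trans (dist-minimal (V ++ʷ W)) (≤-reflexive (trans (wlen-++ V W) (cong₂ _+_ |V| |W|)))

    dist-adj : ∀ {u v} → Adj G u v → dist u v ≤ 1
    dist-adj e = dist-minimal (e ∷ [])

  module TreeReconfiguration (tree : IsTree G) where

    open Distance (proj₁ tree) public

    Side : Fin n → Fin n → Fin n → Set
    Side x y v = dist v x < dist v y

    side? : ∀ x y → Decidable (Side x y)
    side? x y v = dist v x <? dist v y

    y∉Side : ∀ {x y} → ¬ Side x y y
    y∉Side {x} {y} y-near = n≮0 (subst (dist y x <_) (dist-refl y) y-near)

    x∈Side : ∀ {x y} → Adj G x y → Side x y x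
    x∈Side {x} {y} x~y = subst (_< dist x y) (sym (dist-refl x))
      (n≢0⇒n>0 λ d≡0 → Adj⇒≢ x~y (dist≡0⇒≡ d≡0))

    private
      shorter-than-shortest : ∀ {u t z} (W : Walk G u t) → wlen G W ≡ dist u t → dist u t ≤ dist u z →
                              (P : Walk G u z) → ¬ wlen G P < wlen G W
      shorter-than-shortest W |W| t≤z P P<W =
        <-irrefl refl (≤-<-trans t≤z (≤-<-trans (dist-minimal P) (subst (wlen G P <_) |W| P<W)))

    shortest-avoids : ∀ {u t x y} → dist u t ≤ dist u x → dist u t ≤ dist u y → AvoidingWalk x y u t
    shortest-avoids {u} {t} t≤x t≤y with shortest-walk u t
    ... | W , |W| with avoiding-or-shortcut W
    ... | inj₁ A                = A
    ... | inj₂ (inj₁ (P , P<W)) = ⊥-elim (shorter-than-shortest W |W| t≤x P P<W)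
    ... | inj₂ (inj₂ (P , P<W)) = ⊥-elim (shorter-than-shortest W |W| t≤y P P<W)

    side-boundary : ∀ {x y a b} → Adj G x y → Adj G a b → Side x y a → ¬ Side x y b → a ≡ x × b ≡ y
    side-boundary {x} {y} {a} {b} x~y a~b a-near b-far with a ≟ x ×-dec b ≟ y
    ... | yes ab≡xy = ab≡xy
    ... | no ab≢xy  = ⊥-elim (acyclic⇒no-avoiding-walk (proj₂ tree) x~y (reverseᵃ to-x ++ᵃ (a~b ∷⟨ not-xy ⟩ to-y)))
      where
      to-x : AvoidingWalk x y a x
      to-x = shortest-avoids ≤-refl (<⇒≤ a-near)
      to-y : AvoidingWalk x y b y
      to-y = shortest-avoids (≮⇒≥ b-far) ≤-refl
      not-xy : ¬ SameEdge a b x y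
      not-xy (inj₁ ab≡xy)       = ab≢xy ab≡xy
      not-xy (inj₂ (refl , _)) = y∉Side a-near

    private
      through-edge : ∀ {x y w z} → Adj G x y → (W : Walk G w z) → ¬ Side x y w → Side x y z →
                     ∃₂ λ (P : Walk G w y) (Q : Walk G x z) → wlen G P + suc (wlen G Q) ≡ wlen G W
      through-edge x~y [] w-far z-near = ⊥-elim (w-far z-near)
      through-edge {x} {y} x~y (_∷_ {v = u} w~u W) w-far z-near with side? x y u
      ... | yes u-near with side-boundary x~y (Adj-sym w~u) u-near w-far
      ...   | refl , refl = [] , W , refl
      through-edge x~y (w~u ∷ W) w-far z-near | no u-far with through-edge x~y W u-far z-near
      ... | P , Q , split = w~u ∷ P , Q , cong suc split

    dist-through-edge : ∀ {x y w z} → Adj G x y → ¬ Side x y w → Side x y z → dist w y + suc (dist x z) ≤ dist w z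
    dist-through-edge {x} {y} {w} {z} x~y w-far z-near with shortest-walk w z
    ... | W , |W| with through-edge x~y W w-far z-near
    ... | P , Q , split = begin
      dist w y + suc (dist x z)     ≤⟨ +-mono-≤ (dist-minimal P) (s≤s (dist-minimal Q)) ⟩
      wlen G P + suc (wlen G Q)     ≡⟨ split ⟩
      wlen G W                      ≡⟨ |W| ⟩
      dist w z                      ∎
      where open ≤-Reasoning

    near : Fin n → Fin n → Fin n → ℕ
    near x y v = when (side? x y v) 1

    side-flow : ∀ {x y a b} → Adj G x y → Adj G a b →
                near x y a + when (a ≟ y ×-dec b ≟ x) 1 ≡ near x y b + when (a ≟ x ×-dec b ≟ y) 1
    side-flow {x} {y} {a} {b} x~y a~b with side? x y a | side? x y b
    ... | yes a-near | yes b-near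
      rewrite when-no {m = 1} (a ≟ y ×-dec b ≟ x) (λ (a≡y , _) → y∉Side (subst (Side x y) a≡y a-near))
            | when-no {m = 1} (a ≟ x ×-dec b ≟ y) (λ (_ , b≡y) → y∉Side (subst (Side x y) b≡y b-near)) = refl
    ... | no a-far | no b-far
      rewrite when-no {m = 1} (a ≟ y ×-dec b ≟ x) (λ (_ , b≡x) → b-far (subst (Side x y) (sym b≡x) (x∈Side x~y)))
            | when-no {m = 1} (a ≟ x ×-dec b ≟ y) (λ (a≡x , _) → a-far (subst (Side x y) (sym a≡x) (x∈Side x~y))) = refl
    ... | yes a-near | no b-far with side-boundary x~y a~b a-near b-far
    ...   | refl , refl
      rewrite when-no {m = 1} (x ≟ y ×-dec y ≟ x) (λ (x≡y , _) → y∉Side (subst (Side x y) x≡y a-near))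
            | when-yes {m = 1} (x ≟ x ×-dec y ≟ y) (refl , refl) = refl
    side-flow {x} {y} x~y a~b | no a-far | yes b-near with side-boundary x~y (Adj-sym a~b) b-near a-far
    ...   | refl , refl
      rewrite when-yes {m = 1} (y ≟ y ×-dec x ≟ x) (refl , refl)
            | when-no {m = 1} (y ≟ x ×-dec x ≟ y) (λ (y≡x , _) → y∉Side (subst (Side x y) (sym y≡x) b-near)) = refl

    private
      pass-tokens : ∀ K K′ J na nb p q c c′ → K + nb ≡ K′ + na → na + p ≡ nb + q → K′ + c ≡ J + c′ →
                    K + (p + c) ≡ J + (q + c′)
      pass-tokens K K′ J na nb p q c c′ slid crossed rest = +-cancelʳ-≡ nb _ _ (begin
        K + (p + c) + nb     ≡⟨ solve 4 (λ K p c nb → (K ⊕ (p ⊕ c)) ⊕ nb ⊜ (K ⊕ nb) ⊕ (p ⊕ c)) refl K p c nb ⟩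
        (K + nb) + (p + c)   ≡⟨ cong (_+ (p + c)) slid ⟩
        (K′ + na) + (p + c)  ≡⟨ solve 4 (λ K na p c → (K ⊕ na) ⊕ (p ⊕ c) ⊜ (K ⊕ c) ⊕ (na ⊕ p)) refl K′ na p c ⟩
        (K′ + c) + (na + p)  ≡⟨ cong₂ _+_ rest crossed ⟩
        (J + c′) + (nb + q)  ≡⟨ solve 4 (λ J c nb q → (J ⊕ c) ⊕ (nb ⊕ q) ⊜ (J ⊕ (q ⊕ c)) ⊕ nb) refl J c′ nb q ⟩
        J + (q + c′) + nb    ∎)
        where open ≡-Reasoning

    near-balance : ∀ {x y K J} → Adj G x y → (S : TSSeqₖ G k K J) →
                   ∑∈ K (near x y) + count G S y x ≡ ∑∈ J (near x y) + count G S x y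
    near-balance x~y [ _ , _ ] = refl
    near-balance {x = x} {y = y} {K} {J} x~y (step {I' = K′} K-ind K-size a b slide S)
      rewrite count-step K-ind K-size a b slide S y x | count-step K-ind K-size a b slide S x y =
      pass-tokens (∑∈ K (near x y)) (∑∈ K′ (near x y)) (∑∈ J (near x y)) _ _ _ _ _ _
                  (∑∈-slide slide λ v _ → near x y v) (side-flow x~y (proj₁ slide)) (near-balance x~y S)

    misplaced-token : ∀ {x y K J} {π : Permutation′ n} → MapsOnto π K J → ∑∈ K (near x y) < ∑∈ J (near x y) →
                      ∃ λ w → w ∈ K × ¬ Side x y w × Side x y (π ⟨$⟩ʳ w)
    misplaced-token {x = x} {y} {K} {J} {π} maps fewer with ∑-<-witness (subst (∑∈ K (near x y) <_) reindexed fewer)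
      where
      reindexed : ∑∈ J (near x y) ≡ ∑ λ v → when (v ∈? K) (near x y (π ⟨$⟩ʳ v))
      reindexed = trans (∑-permute _ π)
        (sum-cong-≗ λ v → when-⇔ (⇔-sym (MapsOnto.∈⇔ maps v)) (π ⟨$⟩ʳ v ∈? J) (v ∈? K))
    ... | w , gap with w ∈? K | side? x y w | side? x y (π ⟨$⟩ʳ w)
    ...   | yes w∈K | no w-far | yes πw-near = w , w∈K , w-far , πw-near
    ...   | yes _   | yes _    | yes _        = ⊥-elim (<-irrefl refl gap)
    ...   | yes _   | yes _    | no _         = ⊥-elim (<⇒≱ gap z≤n)
    ...   | yes _   | no _     | no _         = ⊥-elim (<-irrefl refl gap)
    ...   | no _    | _        | _            = ⊥-elim (<-irrefl refl gap)

    cost : Subset n → Permutation′ n → ℕ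
    cost K π = ∑∈ K λ v → dist v (π ⟨$⟩ʳ v)

    private
      cost-slide : ∀ {K K′ x y} (π : Permutation′ n) → Step G K K′ x y →
                   cost K (Perm.transpose x y ∘ₚ π) + dist y (π ⟨$⟩ʳ y) ≡ cost K′ π + dist x (π ⟨$⟩ʳ y)
      cost-slide π slide = ∑∈-slide slide λ v u → dist v (π ⟨$⟩ʳ u)

    cost-slide-≤ : ∀ {K K′ x y} (π : Permutation′ n) → Step G K K′ x y →
                   cost K (Perm.transpose x y ∘ₚ π) ≤ suc (cost K′ π)
    cost-slide-≤ {K} {K′} {x} {y} π slide = +-cancelʳ-≤ (dist y πy) _ _ (begin
      cost K (Perm.transpose x y ∘ₚ π) + dist y πy  ≡⟨ cost-slide π slide ⟩
      cost K′ π + dist x πy                         ≤⟨ +-monoʳ-≤ (cost K′ π) (≤-trans (dist-triangle x y πy)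
                                                                               (+-monoˡ-≤ _ (dist-adj (proj₁ slide)))) ⟩
      cost K′ π + suc (dist y πy)                   ≡⟨ +-suc (cost K′ π) _ ⟩
      suc (cost K′ π) + dist y πy                   ∎)
      where
      open ≤-Reasoning
      πy = π ⟨$⟩ʳ y

    private
      detour : ∀ C C′ C″ a b c d e f → C + a ≡ C′ + b → C′ + c + d ≡ C″ + a + e → e ≤ f + c → f + suc b ≤ d →
               suc C ≤ C″
      detour C C′ C″ a b c d e f slid swapped triangle through = +-cancelʳ-≤ (a + c + f + b) _ _ (begin
        suc C + (a + c + f + b)
          ≡⟨ solve 6 (λ one C a c f b → (one ⊕ C) ⊕ (((a ⊕ c) ⊕ f) ⊕ b) ⊜ ((C ⊕ a) ⊕ c) ⊕ (f ⊕ (one ⊕ b)))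
                     refl 1 C a c f b ⟩
        (C + a) + c + (f + suc b)     ≤⟨ +-mono-≤ (≤-reflexive (cong (_+ c) slid)) through ⟩
        (C′ + b) + c + d              ≡⟨ solve 4 (λ C b c d → ((C ⊕ b) ⊕ c) ⊕ d ⊜ ((C ⊕ c) ⊕ d) ⊕ b) refl C′ b c d ⟩
        (C′ + c + d) + b              ≡⟨ cong (_+ b) swapped ⟩
        (C″ + a + e) + b              ≤⟨ +-monoˡ-≤ b (+-monoʳ-≤ (C″ + a) triangle) ⟩
        (C″ + a + (f + c)) + b
          ≡⟨ solve 5 (λ C a f c b → ((C ⊕ a) ⊕ (f ⊕ c)) ⊕ b ⊜ C ⊕ (((a ⊕ c) ⊕ f) ⊕ b)) refl C″ a f c b ⟩
        C″ + (a + c + f + b)          ∎)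
        where open ≤-Reasoning

    cost-slide-swap : ∀ {K K′ x y w} (π : Permutation′ n) → Step G K K′ x y → w ∈ K′ →
                      ¬ Side x y w → Side x y (π ⟨$⟩ʳ w) →
                      suc (cost K (Perm.transpose x y ∘ₚ (Perm.transpose y w ∘ₚ π))) ≤ cost K′ π
    cost-slide-swap {K} {K′} {x} {y} {w} π slide@(_ , _ , (y∈K′ , _)) w∈K′ w-far πw-near =
      detour _ (cost K′ ρ) _ _ _ _ _ _ _ slid
             (∑∈-swap y∈K′ w∈K′ λ v u → dist v (π ⟨$⟩ʳ u))
             (dist-triangle w y (π ⟨$⟩ʳ y)) (dist-through-edge (proj₁ slide) w-far πw-near)
      where
      ρ = Perm.transpose y w ∘ₚ π
      slid : cost K (Perm.transpose x y ∘ₚ ρ) + dist y (π ⟨$⟩ʳ w) ≡ cost K′ ρ + dist x (π ⟨$⟩ʳ w)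
      slid = subst (λ u → cost K (Perm.transpose x y ∘ₚ ρ) + dist y (π ⟨$⟩ʳ u) ≡ cost K′ ρ + dist x (π ⟨$⟩ʳ u))
                   (transpose-ˡ y w) (cost-slide ρ slide)

    cost-id : ∀ K → cost K Perm.id ≡ 0
    cost-id K = ∑-zero λ v → trans (cong (when (v ∈? K)) (dist-refl v)) (when-0 (v ∈? K))
      where
      when-0 : ∀ {P : Set} (p? : Dec P) → when p? 0 ≡ 0
      when-0 (yes _) = refl
      when-0 (no _)  = refl

    private
      tokens-behind : ∀ {A B c₁ c₂} → A + c₂ ≡ B + c₁ → c₁ < c₂ → A < B
      tokens-behind {A} {B} {c₁} {c₂} balance c₁<c₂ = +-cancelʳ-≤ c₂ (suc A) B (begin
        suc A + c₂   ≡⟨ cong suc balance ⟩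
        suc B + c₁   ≡⟨ +-suc B c₁ ⟨
        B + suc c₁   ≤⟨ +-monoʳ-≤ B c₁<c₂ ⟩
        B + c₂       ∎)
        where open ≤-Reasoning

    Bound : ∀ {K J} → TSSeqₖ G k K J → Set
    Bound {K = K} {J} S = ∃ λ π → MapsOnto π K J × cost K π + D G S ≤ len G S

    private
      extend-bound : ∀ {K K′ J x y} (K-ind : Independent G K) (K-size : ∣ K ∣ ≡ k) (slide : Step G K K′ x y)
                     (S : TSSeqₖ G k K′ J) → Bound S → Dec (count G S y x ≤ count G S x y) →
                     Bound (step K-ind K-size x y slide S)
      extend-bound {K = K} {K′} {x = x} {y} K-ind K-size slide S (π , maps , bound) (yes balanced) =
        Perm.transpose x y ∘ₚ π , maps-slide slide maps , (begin
          cost K (Perm.transpose x y ∘ₚ π) + D G (step K-ind K-size x y slide S)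
            ≤⟨ +-mono-≤ (cost-slide-≤ π slide) (≤-reflexive (D-step-balanced K-ind K-size slide S balanced)) ⟩
          suc (cost K′ π + D G S) ≤⟨ s≤s bound ⟩
          suc (len G S) ∎)
        where open ≤-Reasoning
      extend-bound {K = K} {K′} {x = x} {y} K-ind K-size slide@(x~y , _ , (y∈K′ , _)) S (π , maps , bound) (no unbalanced) =
        swap-and-slide (misplaced-token {x = x} {y} {K′} maps (tokens-behind (near-balance x~y S) (≰⇒> unbalanced)))
        where
        swap-and-slide : (∃ λ w → w ∈ K′ × ¬ Side x y w × Side x y (π ⟨$⟩ʳ w)) → Bound (step K-ind K-size x y slide S)
        swap-and-slide (w , w∈K′ , w-far , πw-near) =
          π′ , maps-slide slide (maps-swap y∈K′ w∈K′ maps) , (begin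
            cost K π′ + D G (step K-ind K-size x y slide S)   ≤⟨ +-monoʳ-≤ (cost K π′) (D-step-≤ K-ind K-size slide S) ⟩
            cost K π′ + (2 + D G S)                         ≡⟨ trans (+-suc (cost K π′) _) (cong suc (+-suc (cost K π′) _)) ⟩
            suc (suc (cost K π′)) + D G S                   ≤⟨ +-monoˡ-≤ (D G S)
                                                                 (s≤s (cost-slide-swap π slide w∈K′ w-far πw-near)) ⟩
            suc (cost K′ π + D G S)                         ≤⟨ s≤s bound ⟩
            suc (len G S)                                   ∎)
          where
          open ≤-Reasoning
          π′ = Perm.transpose x y ∘ₚ (Perm.transpose y w ∘ₚ π)

    assignment-bound : ∀ {K J} (S : TSSeqₖ G k K J) → Bound S
    assignment-bound {K = K} S@([ K-ind , K-size ]) =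
      Perm.id , mapsOnto (λ _ → ⇔-id _) , ≤-reflexive (cong₂ _+_ (cost-id K) (D-[] K-ind K-size))
    assignment-bound (step K-ind K-size x y slide S) =
      extend-bound K-ind K-size slide S (assignment-bound S) (count G S y x ≤? count G S x y)

  elems-⤖ : ∀ {I J} {π : Permutation′ n} → MapsOnto π I J → Elem G I ⤖ Elem G J
  elems-⤖ {I} {J} {π} (mapsOnto maps) = mk⤖ {to = to} (injective , surjective)
    where
    elem-≡ : ∀ {K : Subset n} {v v′} → v ≡ v′ → (p : v ∈ K) (p′ : v′ ∈ K) → _≡_ {A = Elem G K} (v , p) (v′ , p′)
    elem-≡ refl p p′ = cong (_ ,_) ([]=-irrelevant p p′)
    to : Elem G I → Elem G J
    to (v , v∈I) = π ⟨$⟩ʳ v , Equivalence.to (maps v) v∈I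
    injective : ∀ {a b} → to a ≡ to b → a ≡ b
    injective {v , p} {v′ , p′} eq =
      elem-≡ (trans (sym (inverseˡ π)) (trans (cong ((π ⟨$⟩ˡ_) ∘ proj₁) eq) (inverseˡ π))) p p′
    surjective : ∀ u → ∃ λ a → ∀ {b} → b ≡ a → to b ≡ u
    surjective (u , u∈J) = (π ⟨$⟩ˡ u , Equivalence.from (maps _) (subst (_∈ J) (sym (inverseʳ π)) u∈J)) ,
                           λ { refl → elem-≡ (inverseʳ π) _ _ }

  sumOver-∑∈ : (I : Subset n) (w : Fin n → ℕ) → sumOver G I (λ v _ → w v) ≡ ∑∈ I w
  sumOver-∑∈ I w = trans (sum-map-allFin summand) (sum-cong-≗ summand-≗)
    where
    -- `sumOver` sums a function local to Defs; unification against `sum (map F (allFin n))` names it.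
    summandOf : {F : Fin n → ℕ} → sum (map F (allFin n)) ≡ sumOver G I (λ v _ → w v) → Fin n → ℕ
    summandOf {F} _ = F
    summand : Fin n → ℕ
    summand = summandOf refl
    summand-≗ : ∀ v → summand v ≡ when (v ∈? I) (w v)
    summand-≗ v with v ∈? I
    ... | yes _ = refl
    ... | no _  = refl

lemma1 : ∀ {n} (T : Graph n) → IsTree T →
           (I J : Subset n) → Independent T I → Independent T J → ∣ I ∣ ≡ ∣ J ∣ →
           TSSeq T I J →
           (S : TSSeq T I J) → (m d : ℕ) → IsMStar T I J m → IsDStar T I J d →
           m + d ≤ len T S
lemma1 T tree I J _ _ _ _ S m d (_ , m-minimal) (_ , d-minimal) with TreeReconfiguration.assignment-bound T tree S
... | π , maps , bound = begin
  m + d                  ≤⟨ +-mono-≤ (m-minimal (elems-⤖ T maps) _ (δ , (λ v _ → dist-isDist v (π ⟨$⟩ʳ v)) , refl))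
                                     (d-minimal S) ⟩
  sumOver T I δ + D T S  ≡⟨ cong (_+ D T S) (sumOver-∑∈ T I λ v → dist v (π ⟨$⟩ʳ v)) ⟩
  cost I π + D T S       ≤⟨ bound ⟩
  len T S                ∎
  where
  open ≤-Reasoning
  open TreeReconfiguration T tree using (dist; dist-isDist; cost)
  δ : (v : Fin _) → v ∈ I → ℕ
  δ v _ = dist v (π ⟨$⟩ʳ v)
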